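{- For every graph $G$ with $n$ vertices, $P(G,m)-P_{DP}(G,m) = O(m^{n-2})$ as $m\to\infty$.
   Context: All graphs are finite and simple. For $m\in\mathbb{N}$, $P(G,m)$ denotes the number of proper $m$-colorings of $G$. A cover of a graph $G$ is a pair $\mathcal{H}=(L,H)$ where $H$ is a graph and $L:V(G)\to\mathcal{P}(V(H))$ satisfies: (1) the sets $L(u)$, $u\in V(G)$, partition $V(H)$; (2) each $H[L(u)]$ is complete; (3) if $E_H(L(u),L(v))$ is nonempty then $u=v$ or $uv\in E(G)$; (4) if $uv\in E(G)$ then $E_H(L(u),L(v))$ is a matching (possibly empty). Here $E_H(S,U)$ is the set of edges of $H$ with one endpoint in $S$ and one in $U$. The cover is $m$-fold if $|L(u)|=m$ for all $u$. An $\mathcal{H}$-coloring of $G$ is an independent set of $H$ of size $|V(G)|$. $P_{DP}(G,\mathcal{H})$ is the number of $\mathcal{H}$-colorings, and $P_{DP}(G,m)$ is the minimum of $P_{DP}(G,\mathcal{H})$ over all $m$-fold covers $\mathcal{H}$ of $G$. -}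

module Defs where

open import Data.Nat using (ℕ; zero; suc; _+_; _≤_)
open import Data.Bool using (Bool; true; false; _∧_; _∨_; not; if_then_else_)
open import Data.Fin using (Fin)
open import Data.Fin.Properties using (_≟_)
open import Data.Vec using (Vec; []; _∷_; lookup)
open import Data.List using (List; []; _∷_; map; concatMap; filter; length; allFin; foldr)
open import Data.Product using (Σ; _×_; _,_; ∃-syntax)
open import Relation.Nullary using (¬_)
open import Relation.Nullary.Decidable using (⌊_⌋)
open import Relation.Binary.PropositionalEquality using (_≡_)

record Graph (n : ℕ) : Set where
  field
    adj    : Fin n → Fin n → Bool
    sym    : ∀ u v → adj u v ≡ adj v u
    irrefl : ∀ u → adj u u ≡ false
open Graph public

vecsOver : {A : Set} → List A → (k : ℕ) → List (Vec A k)
vecsOver xs zero = [] ∷ []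
vecsOver xs (suc k) = concatMap (λ x → map (x ∷_) (vecsOver xs k)) xs

allF : {k : ℕ} → (Fin k → Bool) → Bool
allF {k} p = foldr (λ x b → p x ∧ b) true (allFin k)

count : {A : Set} → (A → Bool) → List A → ℕ
count p xs = length (filter (λ x → p x Data.Bool.≟ true) xs)

eqF : {k : ℕ} → Fin k → Fin k → Bool
eqF a b = ⌊ a ≟ b ⌋

isProper : {n m : ℕ} → Graph n → Vec (Fin m) n → Bool
isProper G c = allF λ u → allF λ v → not (adj G u v ∧ eqF (lookup c u) (lookup c v))

P : {n : ℕ} → Graph n → (m : ℕ) → ℕ
P {n} G m = count (isProper G) (vecsOver (allFin m) n)

-- An m-fold cover (L,H) of G.  Up to isomorphism we take V(H) = Fin n × Fin m
-- with L(u) = {u} × Fin m (this realises condition (1) and |L(u)| = m).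
-- Hadj u i v j  means  (u,i)(v,j) ∈ E(H).
record Cover {n : ℕ} (G : Graph n) (m : ℕ) : Set where
  field
    Hadj     : Fin n → Fin m → Fin n → Fin m → Bool
    Hsym     : ∀ u i v j → Hadj u i v j ≡ Hadj v j u i
    Hirrefl  : ∀ u i → Hadj u i u i ≡ false
    clique   : ∀ u i j → ¬ (i ≡ j) → Hadj u i u j ≡ true
    onlyEdge : ∀ u v i j → ¬ (u ≡ v) → Hadj u i v j ≡ true → adj G u v ≡ true
    -- (4) E_H(L(u),L(v)) is a matching (together with Hsym this covers both sides)
    matching : ∀ u v i j j' → ¬ (u ≡ v) →
               Hadj u i v j ≡ true → Hadj u i v j' ≡ true → j ≡ j'
open Cover public

-- subsets of V(H) = Fin n × Fin m, as characteristic vectors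
Subset : ℕ → ℕ → Set
Subset n m = Vec (Vec Bool m) n

mem : {n m : ℕ} → Subset n m → Fin n → Fin m → Bool
mem S u i = lookup (lookup S u) i

size : {n m : ℕ} → Subset n m → ℕ
size {n} {m} S = foldr _+_ 0 (map (λ u → count (mem S u) (allFin m)) (allFin n))

isIndependent : {n m : ℕ} {G : Graph n} → Cover G m → Subset n m → Bool
isIndependent H S =
  allF λ u → allF λ i → allF λ v → allF λ j →
    not (mem S u i ∧ mem S v j ∧ Hadj H u i v j)

isHColoring : {n m : ℕ} {G : Graph n} → Cover G m → Subset n m → Bool
isHColoring {n} H S = isIndependent H S ∧ ⌊ size S Data.Nat.≟ n ⌋

PDPcover : {n m : ℕ} {G : Graph n} → Cover G m → ℕ
PDPcover {n} {m} H =
  count (isHColoring H) (vecsOver (vecsOver (true ∷ false ∷ []) m) n)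

IsPDP : {n : ℕ} → Graph n → (m : ℕ) → ℕ → Set
IsPDP G m k = (∃[ H ] PDPcover {m = m} {G = G} H ≡ k)
            × (∀ (H : Cover G m) → k ≤ PDPcover H)

module Submission where

-- Both quantities are compared on the sample space of all m^n maps
-- c : V(G) → Fin m.  For an edge e = uv (u < v) let A_e be the event
-- "c u = c v" and, for an m-fold cover H, let B_e be the event
-- "(u , c u) and (v , c v) are adjacent in H".
--  * Proper colourings avoid every A_e, so the second Bonferroni inequality
--    gives  P(G,m) + ∑_e |A_e| ≤ m^n + ∑_{e≠f} |A_e ∩ A_f|.
--  * A map avoiding every B_e is an H-colouring, so the union bound gives
--    m^n ≤ P_DP(G,H) + ∑_e |B_e|.
--  * |A_e| = m^(n−1), the matching condition gives |B_e| ≤ m^(n−1), and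
--    |A_e ∩ A_f| = m^(n−2) for distinct edges e, f.
-- Hence P(G,m) ≤ P_DP(G,H) + C·m^(n−2) for every cover H, C being the
-- number of pairs of candidate edges, while the trivial cover (whose
-- H-colourings are the proper colourings) gives P_DP(G,m) ≤ P(G,m).

open import Defs hiding (sym)
open import Data.Nat using (ℕ; zero; suc; _+_; _*_; _^_; _∸_; ∣_-_∣; _≤_; z≤n; s≤s; >-nonZero)
import Data.Nat as ℕ
open import Data.Nat.Properties
open import Algebra.Properties.CommutativeSemigroup +-commutativeSemigroup using (interchange; xy∙z≈xz∙y)
open import Data.Bool using (Bool; true; false; _∧_; not; if_then_else_)
import Data.Bool.Properties as Bool
open import Data.Fin using (Fin; zero; suc; _<_)
import Data.Fin.Properties as Fin
open import Data.Vec using (Vec; []; _∷_; lookup; _[_]≔_; tabulate)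
import Data.Vec as V
import Data.Vec.Properties as Vec
open import Data.List using (List; []; _∷_; map; concatMap; length; allFin; foldr; _++_)
open import Data.List.Properties using (length-tabulate; map-tabulate)
open import Data.List.Relation.Unary.Any using (here; there)
open import Data.List.Membership.Propositional using (_∈_; lose)
open import Data.List.Membership.Propositional.Properties using (∈-map⁺; ∈-concatMap⁺; ∈-allFin)
open import Data.Product using (_×_; _,_; proj₁; proj₂; uncurry; ∃-syntax)
open import Data.Sum using (_⊎_; inj₁; inj₂)
open import Data.Empty using (⊥-elim)
open import Function using (_∘_; id)
open import Relation.Nullary using (¬_; Dec; does; yes; no; map′; _×-dec_)
open import Relation.Nullary.Decidable using (⌊_⌋; dec-true; dec-false; isYes≗does)
open import Relation.Binary.Definitions using (DecidableEquality; tri<; tri≈; tri>)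
open import Relation.Binary.PropositionalEquality

𝟙 : Bool → ℕ
𝟙 true  = 1
𝟙 false = 0

𝟙≤1 : ∀ b → 𝟙 b ≤ 1
𝟙≤1 true  = s≤s z≤n
𝟙≤1 false = z≤n

𝟙-∧ : ∀ a b → 𝟙 (a ∧ b) ≡ 𝟙 a * 𝟙 b
𝟙-∧ true  b = sym (+-identityʳ (𝟙 b))
𝟙-∧ false b = refl

𝟙-mono : ∀ {a b} → (a ≡ true → b ≡ true) → 𝟙 a ≤ 𝟙 b
𝟙-mono {false} a⇒b = z≤n
𝟙-mono {true}  a⇒b rewrite a⇒b refl = ≤-refl

𝟙≢0 : ∀ {b} → ¬ 𝟙 b ≡ 0 → b ≡ true
𝟙≢0 {true}  _   = refl
𝟙≢0 {false} b≢0 = ⊥-elim (b≢0 refl)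

𝟙*≢0 : ∀ b k → ¬ 𝟙 b * k ≡ 0 → b ≡ true
𝟙*≢0 true  k _   = refl
𝟙*≢0 false k ≢0 = ⊥-elim (≢0 refl)

∧-true : ∀ {a b} → a ∧ b ≡ true → a ≡ true × b ≡ true
∧-true {true} {true} _ = refl , refl

witness : {P : Set} (d : Dec P) → does d ≡ true → P
witness (yes p) _ = p

does-sym : {A : Set} (_≟_ : DecidableEquality A) (a b : A) → does (a ≟ b) ≡ does (b ≟ a)
does-sym _≟_ a b with a ≟ b | b ≟ a
... | yes _   | yes _   = refl
... | no  _   | no  _   = refl
... | yes a≡b | no  b≢a = ⊥-elim (b≢a (sym a≡b))
... | no  a≢b | yes b≡a = ⊥-elim (a≢b (sym b≡a))

∑ : {A : Set} → List A → (A → ℕ) → ℕ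
∑ []       f = 0
∑ (x ∷ xs) f = f x + ∑ xs f

syntax ∑ xs (λ x → e) = ∑[ x ∈ xs ] e

module _ {A : Set} where

  ∑-cong : (xs : List A) {f g : A → ℕ} → (∀ x → f x ≡ g x) → ∑ xs f ≡ ∑ xs g
  ∑-cong []       f≗g = refl
  ∑-cong (x ∷ xs) f≗g = cong₂ _+_ (f≗g x) (∑-cong xs f≗g)

  ∑-mono : (xs : List A) {f g : A → ℕ} → (∀ x → f x ≤ g x) → ∑ xs f ≤ ∑ xs g
  ∑-mono []       f≤g = z≤n
  ∑-mono (x ∷ xs) f≤g = +-mono-≤ (f≤g x) (∑-mono xs f≤g)

  ∑-+ : (xs : List A) (f g : A → ℕ) → ∑[ x ∈ xs ] (f x + g x) ≡ ∑ xs f + ∑ xs g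
  ∑-+ []       f g = refl
  ∑-+ (x ∷ xs) f g = trans (cong (f x + g x +_) (∑-+ xs f g)) (interchange (f x) (g x) (∑ xs f) (∑ xs g))

  ∑-*ˡ : (xs : List A) (k : ℕ) (f : A → ℕ) → ∑[ x ∈ xs ] (k * f x) ≡ k * ∑ xs f
  ∑-*ˡ []       k f = sym (*-zeroʳ k)
  ∑-*ˡ (x ∷ xs) k f = trans (cong (k * f x +_) (∑-*ˡ xs k f)) (sym (*-distribˡ-+ k (f x) _))

  ∑-*ʳ : (xs : List A) (k : ℕ) (f : A → ℕ) → ∑[ x ∈ xs ] (f x * k) ≡ ∑ xs f * k
  ∑-*ʳ xs k f = trans (∑-cong xs (λ x → *-comm (f x) k)) (trans (∑-*ˡ xs k f) (*-comm k _))

  ∑-const : (xs : List A) (k : ℕ) → ∑[ _ ∈ xs ] k ≡ length xs * k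
  ∑-const []       k = refl
  ∑-const (x ∷ xs) k = cong (k +_) (∑-const xs k)

  ∑-zero : (xs : List A) → ∑[ _ ∈ xs ] 0 ≡ 0
  ∑-zero xs = trans (∑-const xs 0) (*-zeroʳ (length xs))

  ∑-one : (xs : List A) → ∑[ _ ∈ xs ] 1 ≡ length xs
  ∑-one xs = trans (∑-const xs 1) (*-identityʳ (length xs))

  ∑-++ : (xs ys : List A) (f : A → ℕ) → ∑ (xs ++ ys) f ≡ ∑ xs f + ∑ ys f
  ∑-++ []       ys f = refl
  ∑-++ (x ∷ xs) ys f = trans (cong (f x +_) (∑-++ xs ys f)) (sym (+-assoc (f x) _ _))

∑-swap : {A B : Set} (xs : List A) (ys : List B) (f : A → B → ℕ) →
  ∑[ x ∈ xs ] ∑ ys (f x) ≡ ∑[ y ∈ ys ] ∑[ x ∈ xs ] f x y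
∑-swap []       ys f = sym (∑-zero ys)
∑-swap (x ∷ xs) ys f =
  trans (cong (∑ ys (f x) +_) (∑-swap xs ys f)) (sym (∑-+ ys (f x) (λ y → ∑[ x′ ∈ xs ] f x′ y)))

∑-map : {A B : Set} (g : A → B) (xs : List A) (f : B → ℕ) → ∑ (map g xs) f ≡ ∑ xs (f ∘ g)
∑-map g []       f = refl
∑-map g (x ∷ xs) f = cong (f (g x) +_) (∑-map g xs f)

productWith : {A B C : Set} → (A → B → C) → List A → List B → List C
productWith f xs ys = concatMap (λ x → map (f x) ys) xs

∑-productWith : {A B C : Set} (f : A → B → C) (xs : List A) (ys : List B) (g : C → ℕ) →
  ∑ (productWith f xs ys) g ≡ ∑[ x ∈ xs ] ∑[ y ∈ ys ] g (f x y)
∑-productWith f []       ys g = refl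
∑-productWith f (x ∷ xs) ys g =
  trans (∑-++ (map (f x) ys) _ g) (cong₂ _+_ (∑-map (f x) ys g) (∑-productWith f xs ys g))

count≡∑ : {A : Set} (p : A → Bool) (xs : List A) → count p xs ≡ ∑[ x ∈ xs ] 𝟙 (p x)
count≡∑ p []       = refl
count≡∑ p (x ∷ xs) with p x
... | true  = cong suc (count≡∑ p xs)
... | false = count≡∑ p xs

-- Occurrence counts with respect to a decidable equality.  An
-- enumeration of A lists every element exactly once; its tails are
-- merely repetition-free.
module _ {A : Set} (_≟ᴬ_ : DecidableEquality A) where

  occurrences : A → List A → ℕ
  occurrences a xs = ∑[ x ∈ xs ] 𝟙 (does (x ≟ᴬ a))

  Enumerates : List A → Set
  Enumerates xs = ∀ a → occurrences a xs ≡ 1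

  RepetitionFree : List A → Set
  RepetitionFree xs = ∀ a → occurrences a xs ≤ 1

  enumerates⇒repetitionFree : (xs : List A) → Enumerates xs → RepetitionFree xs
  enumerates⇒repetitionFree xs en a = ≤-reflexive (en a)

  ∑-indicator : (xs : List A) → Enumerates xs → (f : A → ℕ) (a : A) →
    ∑[ x ∈ xs ] (𝟙 (does (x ≟ᴬ a)) * f x) ≡ f a
  ∑-indicator xs en f a = begin
    ∑[ x ∈ xs ] (𝟙 (does (x ≟ᴬ a)) * f x) ≡⟨ ∑-cong xs move ⟩
    ∑[ x ∈ xs ] (𝟙 (does (x ≟ᴬ a)) * f a) ≡⟨ ∑-*ʳ xs (f a) _ ⟩
    occurrences a xs * f a                ≡⟨ cong (_* f a) (en a) ⟩
    1 * f a                               ≡⟨ *-identityˡ (f a) ⟩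
    f a                                   ∎
    where
    open ≡-Reasoning
    move : ∀ x → 𝟙 (does (x ≟ᴬ a)) * f x ≡ 𝟙 (does (x ≟ᴬ a)) * f a
    move x with x ≟ᴬ a
    ... | yes refl = refl
    ... | no  _    = refl

  tail-repetitionFree : (x : A) (xs : List A) → RepetitionFree (x ∷ xs) → RepetitionFree xs
  tail-repetitionFree x xs rep a = ≤-trans (m≤n+m _ (𝟙 (does (x ≟ᴬ a)))) (rep a)

  head∉tail : (x : A) (xs : List A) → RepetitionFree (x ∷ xs) → occurrences x xs ≡ 0
  head∉tail x xs rep with occurrences x xs | rep x
  ... | zero | _ = refl
  ... | suc k | x∷xs≤1 rewrite dec-true (x ≟ᴬ x) refl with s≤s () ← x∷xs≤1

  ∑-mono-avoiding : (a : A) (xs : List A) {f g : A → ℕ} → occurrences a xs ≡ 0 →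
    (∀ y → ¬ y ≡ a → f y ≤ g y) → ∑ xs f ≤ ∑ xs g
  ∑-mono-avoiding a []       a∉xs f≤g = z≤n
  ∑-mono-avoiding a (y ∷ xs) a∉xs f≤g with y ≟ᴬ a
  ... | yes _   = ⊥-elim (1+n≢0 a∉xs)
  ... | no  y≢a = +-mono-≤ (f≤g y y≢a) (∑-mono-avoiding a xs a∉xs f≤g)

  ∑-single-support : (xs : List A) → RepetitionFree xs → (r : A → ℕ) (K : ℕ) →
    (∀ x → r x ≤ K) → (∀ x y → ¬ r x ≡ 0 → ¬ r y ≡ 0 → x ≡ y) → ∑ xs r ≤ K
  ∑-single-support []       rep r K r≤K single = z≤n
  ∑-single-support (x ∷ xs) rep r K r≤K single with r x in rx
  ... | zero  = ∑-single-support xs (tail-repetitionFree x xs rep) r K r≤K single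
  ... | suc k = begin
    suc k + ∑ xs r            ≤⟨ +-monoʳ-≤ (suc k) rest≤0 ⟩
    suc k + 0                 ≡⟨ +-identityʳ (suc k) ⟩
    suc k                     ≡⟨ rx ⟨
    r x                       ≤⟨ r≤K x ⟩
    K                         ∎
    where
    open ≤-Reasoning
    vanishes : ∀ y → ¬ y ≡ x → r y ≤ 0
    vanishes y y≢x with r y in ry
    ... | zero  = z≤n
    ... | suc _ = ⊥-elim (y≢x (single y x (1+n≢0 ∘ trans (sym ry)) (1+n≢0 ∘ trans (sym rx))))
    rest≤0 : ∑ xs r ≤ 0
    rest≤0 = ≤-trans (∑-mono-avoiding x xs (head∉tail x xs rep) vanishes) (≤-reflexive (∑-zero xs))

occurrences-productWith : {A B C : Set}
  (_≟ᴬ_ : DecidableEquality A) (_≟ᴮ_ : DecidableEquality B) (_≟ᶜ_ : DecidableEquality C)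
  (f : A → B → C) → (∀ x y a b → does (f x y ≟ᶜ f a b) ≡ does (x ≟ᴬ a) ∧ does (y ≟ᴮ b)) →
  (xs : List A) (ys : List B) (a : A) (b : B) →
  occurrences _≟ᶜ_ (f a b) (productWith f xs ys) ≡ occurrences _≟ᴬ_ a xs * occurrences _≟ᴮ_ b ys
occurrences-productWith _≟ᴬ_ _≟ᴮ_ _≟ᶜ_ f componentwise xs ys a b = begin
  occurrences _≟ᶜ_ (f a b) (productWith f xs ys)
    ≡⟨ ∑-productWith f xs ys _ ⟩
  ∑[ x ∈ xs ] ∑[ y ∈ ys ] 𝟙 (does (f x y ≟ᶜ f a b))
    ≡⟨ ∑-cong xs (λ x → ∑-cong ys (λ y →
         trans (cong 𝟙 (componentwise x y a b)) (𝟙-∧ (does (x ≟ᴬ a)) (does (y ≟ᴮ b))))) ⟩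
  ∑[ x ∈ xs ] ∑[ y ∈ ys ] (𝟙 (does (x ≟ᴬ a)) * 𝟙 (does (y ≟ᴮ b)))
    ≡⟨ ∑-cong xs (λ x → ∑-*ˡ ys (𝟙 (does (x ≟ᴬ a))) _) ⟩
  ∑[ x ∈ xs ] (𝟙 (does (x ≟ᴬ a)) * occurrences _≟ᴮ_ b ys)
    ≡⟨ ∑-*ʳ xs _ _ ⟩
  occurrences _≟ᴬ_ a xs * occurrences _≟ᴮ_ b ys ∎
  where open ≡-Reasoning

length-productWith : {A B C : Set} (f : A → B → C) (xs : List A) (ys : List B) →
  length (productWith f xs ys) ≡ length xs * length ys
length-productWith f xs ys = begin
  length (productWith f xs ys)      ≡⟨ ∑-one (productWith f xs ys) ⟨
  ∑ (productWith f xs ys) (λ _ → 1) ≡⟨ ∑-productWith f xs ys _ ⟩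
  ∑[ x ∈ xs ] ∑[ y ∈ ys ] 1         ≡⟨ ∑-cong xs (λ _ → ∑-one ys) ⟩
  ∑[ x ∈ xs ] length ys             ≡⟨ ∑-const xs (length ys) ⟩
  length xs * length ys             ∎
  where open ≡-Reasoning

∑-allFin-suc : (m : ℕ) (f : Fin (suc m) → ℕ) → ∑ (allFin (suc m)) f ≡ f zero + ∑[ i ∈ allFin m ] f (suc i)
∑-allFin-suc m f =
  cong (f zero +_) (trans (cong (λ l → ∑ l f) (sym (map-tabulate id suc))) (∑-map suc (allFin m) f))

enumerates-allFin : (m : ℕ) → Enumerates Fin._≟_ (allFin m)
enumerates-allFin (suc m) a = trans (∑-allFin-suc m (λ i → 𝟙 (does (i Fin.≟ a)))) (split a)
  where
  split : (a : Fin (suc m)) → 𝟙 (does (zero Fin.≟ a)) + ∑[ i ∈ allFin m ] 𝟙 (does (suc i Fin.≟ a)) ≡ 1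
  split zero    = cong suc (∑-zero (allFin m))
  split (suc a) = enumerates-allFin m a

count-at-most-once : {m : ℕ} (p : Fin m → Bool) → (∀ i j → p i ≡ true → p j ≡ true → i ≡ j) →
  ∑[ i ∈ allFin m ] 𝟙 (p i) ≤ 1
count-at-most-once {m} p once =
  ∑-single-support Fin._≟_ (allFin m) (enumerates⇒repetitionFree Fin._≟_ (allFin m) (enumerates-allFin m))
    (𝟙 ∘ p) 1 (𝟙≤1 ∘ p) (λ i j pi pj → once i j (𝟙≢0 pi) (𝟙≢0 pj))

enumerates-bool : Enumerates Bool._≟_ (true ∷ false ∷ [])
enumerates-bool true  = refl
enumerates-bool false = refl

enumerates-vecsOver : {A : Set} (_≟ᴬ_ : DecidableEquality A) {xs : List A} →
  Enumerates _≟ᴬ_ xs → (k : ℕ) → Enumerates (Vec.≡-dec _≟ᴬ_) (vecsOver xs k)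
enumerates-vecsOver _≟ᴬ_ en zero    []      = refl
enumerates-vecsOver _≟ᴬ_ {xs} en (suc k) (a ∷ w) = begin
  occurrences (Vec.≡-dec _≟ᴬ_) (a ∷ w) (productWith _∷_ xs (vecsOver xs k))
    ≡⟨ occurrences-productWith _≟ᴬ_ (Vec.≡-dec _≟ᴬ_) (Vec.≡-dec _≟ᴬ_) _∷_ (λ _ _ _ _ → refl)
         xs (vecsOver xs k) a w ⟩
  occurrences _≟ᴬ_ a xs * occurrences (Vec.≡-dec _≟ᴬ_) w (vecsOver xs k)
    ≡⟨ cong₂ _*_ (en a) (enumerates-vecsOver _≟ᴬ_ en k w) ⟩
  1 ∎
  where open ≡-Reasoning

length-vecsOver : {A : Set} (xs : List A) (k : ℕ) → length (vecsOver xs k) ≡ length xs ^ k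
length-vecsOver xs zero    = refl
length-vecsOver xs (suc k) =
  trans (length-productWith _∷_ xs (vecsOver xs k)) (cong (length xs *_) (length-vecsOver xs k))

length-allFin : (m : ℕ) → length (allFin m) ≡ m
length-allFin m = length-tabulate id

∈-productWith : {A B C : Set} (f : A → B → C) {xs : List A} {ys : List B} {a : A} {b : B} →
  a ∈ xs → b ∈ ys → f a b ∈ productWith f xs ys
∈-productWith f {a = a} a∈xs b∈ys = ∈-concatMap⁺ (λ x → map (f x) _) (lose a∈xs (∈-map⁺ (f a) b∈ys))

module _ {A B : Set} (_≟ᴬ_ : DecidableEquality A) (_≟ᴮ_ : DecidableEquality B)
         (xs : List A) (ys : List B) (enum-xs : Enumerates _≟ᴬ_ xs) (enum-ys : Enumerates _≟ᴮ_ ys)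
         (f : A → B) where

  ∑-fibres : (g : A → ℕ) → ∑[ y ∈ ys ] ∑[ x ∈ xs ] (𝟙 (does (y ≟ᴮ f x)) * g x) ≡ ∑ xs g
  ∑-fibres g = begin
    ∑[ y ∈ ys ] ∑[ x ∈ xs ] (𝟙 (does (y ≟ᴮ f x)) * g x) ≡⟨ ∑-swap ys xs _ ⟩
    ∑[ x ∈ xs ] ∑[ y ∈ ys ] (𝟙 (does (y ≟ᴮ f x)) * g x) ≡⟨ ∑-cong xs (λ x → ∑-*ʳ ys (g x) _) ⟩
    ∑[ x ∈ xs ] (occurrences _≟ᴮ_ (f x) ys * g x)       ≡⟨ ∑-cong xs (λ x → cong (_* g x) (enum-ys (f x))) ⟩
    ∑[ x ∈ xs ] (1 * g x)                              ≡⟨ ∑-cong xs (λ x → *-identityˡ (g x)) ⟩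
    ∑ xs g                                             ∎
    where open ≡-Reasoning

  count-injection : (∀ x x′ → f x ≡ f x′ → x ≡ x′) → (p : B → Bool) →
    ∑[ x ∈ xs ] 𝟙 (p (f x)) ≤ ∑[ y ∈ ys ] 𝟙 (p y)
  count-injection f-injective p = begin
    ∑[ x ∈ xs ] 𝟙 (p (f x))                                 ≡⟨ ∑-fibres (λ x → 𝟙 (p (f x))) ⟨
    ∑[ y ∈ ys ] ∑[ x ∈ xs ] (𝟙 (does (y ≟ᴮ f x)) * 𝟙 (p (f x))) ≤⟨ ∑-mono ys fibre≤1 ⟩
    ∑[ y ∈ ys ] 𝟙 (p y)                                     ∎
    where
    open ≤-Reasoning
    term≤ : ∀ y x → 𝟙 (does (y ≟ᴮ f x)) * 𝟙 (p (f x)) ≤ 𝟙 (p y)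
    term≤ y x with y ≟ᴮ f x
    ... | yes refl = ≤-reflexive (+-identityʳ _)
    ... | no  _    = z≤n
    fibre≤1 : ∀ y → ∑[ x ∈ xs ] (𝟙 (does (y ≟ᴮ f x)) * 𝟙 (p (f x))) ≤ 𝟙 (p y)
    fibre≤1 y = ∑-single-support _≟ᴬ_ xs (enumerates⇒repetitionFree _≟ᴬ_ xs enum-xs) _ _ (term≤ y)
      (λ x x′ x↦y x′↦y → f-injective x x′
        (trans (sym (witness (y ≟ᴮ f x) (𝟙*≢0 _ _ x↦y))) (witness (y ≟ᴮ f x′) (𝟙*≢0 _ _ x′↦y))))

  count-surjection : (p : B → Bool) (q : A → Bool) →
    (∀ y → p y ≡ true → ∃[ x ] y ≡ f x × q x ≡ true) →
    ∑[ y ∈ ys ] 𝟙 (p y) ≤ ∑[ x ∈ xs ] 𝟙 (q x)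
  count-surjection p q covered = begin
    ∑[ y ∈ ys ] 𝟙 (p y)                                      ≤⟨ ∑-mono ys p≤fibre ⟩
    ∑[ y ∈ ys ] ∑[ x ∈ xs ] (𝟙 (does (y ≟ᴮ f x)) * 𝟙 (q x))  ≡⟨ ∑-fibres (𝟙 ∘ q) ⟩
    ∑[ x ∈ xs ] 𝟙 (q x)                                      ∎
    where
    open ≤-Reasoning
    p≤fibre : ∀ y → 𝟙 (p y) ≤ ∑[ x ∈ xs ] (𝟙 (does (y ≟ᴮ f x)) * 𝟙 (q x))
    p≤fibre y with p y in py
    ... | false = z≤n
    ... | true  with covered y py
    ...   | x₀ , y≡fx₀ , qx₀ = begin
      1
        ≡⟨ cong₂ (λ a b → 𝟙 a * 𝟙 b) (dec-true (y ≟ᴮ f x₀) y≡fx₀) qx₀ ⟨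
      𝟙 (does (y ≟ᴮ f x₀)) * 𝟙 (q x₀)
        ≡⟨ ∑-indicator _≟ᴬ_ xs enum-xs _ x₀ ⟨
      ∑[ x ∈ xs ] (𝟙 (does (x ≟ᴬ x₀)) * (𝟙 (does (y ≟ᴮ f x)) * 𝟙 (q x)))
        ≤⟨ ∑-mono xs (λ x → *-monoˡ-≤ _ (𝟙≤1 (does (x ≟ᴬ x₀)))) ⟩
      ∑[ x ∈ xs ] (1 * (𝟙 (does (y ≟ᴮ f x)) * 𝟙 (q x)))
        ≡⟨ ∑-cong xs (λ x → *-identityˡ _) ⟩
      ∑[ x ∈ xs ] (𝟙 (does (y ≟ᴮ f x)) * 𝟙 (q x)) ∎

every : {A : Set} → (A → Bool) → List A → Bool
every p = foldr (λ x b → p x ∧ b) true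

module _ {A : Set} (p : A → Bool) where

  every-intro : (xs : List A) → (∀ x → p x ≡ true) → every p xs ≡ true
  every-intro []       all = refl
  every-intro (x ∷ xs) all rewrite all x = every-intro xs all

  every-elim : (xs : List A) → every p xs ≡ true → ∀ {x} → x ∈ xs → p x ≡ true
  every-elim (y ∷ xs) holds x∈ with p y in py
  every-elim (y ∷ xs) holds (here refl) | true = py
  every-elim (y ∷ xs) holds (there x∈) | true = every-elim xs holds x∈

allF-elim : {k : ℕ} (p : Fin k → Bool) → allF p ≡ true → ∀ x → p x ≡ true
allF-elim {k} p holds x = every-elim p (allFin k) holds (∈-allFin x)

allF-intro : {k : ℕ} (p : Fin k → Bool) → (∀ x → p x ≡ true) → allF p ≡ true
allF-intro {k} p = every-intro p (allFin k)

∑pairs : {A : Set} → List A → (A → A → ℕ) → ℕ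
∑pairs []       g = 0
∑pairs (x ∷ xs) g = ∑ xs (g x) + ∑pairs xs g

module _ {E : Set} (p : E → Bool) where

  -- The second Bonferroni inequality, for a single sample point:
  -- [no event] ≤ 1 − ∑ [event e] + ∑_{e before f} [events e and f].
  bonferroni : (es : List E) →
    𝟙 (every (not ∘ p) es) + ∑[ e ∈ es ] 𝟙 (p e) ≤ 1 + ∑pairs es (λ e f → 𝟙 (p e ∧ p f))
  bonferroni []       = ≤-refl
  bonferroni (e ∷ es) with p e
  ... | true  = s≤s (m≤m+n _ _)
  ... | false = ≤-trans (bonferroni es)
                  (≤-reflexive (cong (λ z → 1 + (z + ∑pairs es _)) (sym (∑-zero es))))

  union-bound : (es : List E) → 1 ≤ 𝟙 (every (not ∘ p) es) + ∑[ e ∈ es ] 𝟙 (p e)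
  union-bound []       = ≤-refl
  union-bound (e ∷ es) with p e
  ... | true  = s≤s z≤n
  ... | false = union-bound es

∑pairs-∑ : {A C : Set} (xs : List A) (cs : List C) (h : A → A → C → ℕ) →
  ∑[ c ∈ cs ] ∑pairs xs (λ e f → h e f c) ≡ ∑pairs xs (λ e f → ∑[ c ∈ cs ] h e f c)
∑pairs-∑ []       cs h = ∑-zero cs
∑pairs-∑ (x ∷ xs) cs h =
  trans (∑-+ cs _ _) (cong₂ _+_ (∑-swap cs xs (λ c f → h x f c)) (∑pairs-∑ xs cs h))

∑pairs-bound : {A : Set} (_≟ᴬ_ : DecidableEquality A) (xs : List A) → RepetitionFree _≟ᴬ_ xs →
  (g : A → A → ℕ) (K N : ℕ) → (∀ e f → ¬ f ≡ e → K * g e f ≤ N) →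
  K * ∑pairs xs g ≤ ∑pairs xs (λ _ _ → 1) * N
∑pairs-bound _≟ᴬ_ []       rep g K N bound = ≤-reflexive (*-zeroʳ K)
∑pairs-bound _≟ᴬ_ (x ∷ xs) rep g K N bound = begin
  K * (∑ xs (g x) + ∑pairs xs g)
    ≡⟨ *-distribˡ-+ K _ _ ⟩
  K * ∑ xs (g x) + K * ∑pairs xs g
    ≤⟨ +-mono-≤ first (∑pairs-bound _≟ᴬ_ xs (tail-repetitionFree _≟ᴬ_ x xs rep) g K N bound) ⟩
  (∑[ _ ∈ xs ] 1) * N + ∑pairs xs (λ _ _ → 1) * N
    ≡⟨ *-distribʳ-+ N (∑[ _ ∈ xs ] 1) _ ⟨
  ∑pairs (x ∷ xs) (λ _ _ → 1) * N ∎
  where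
  open ≤-Reasoning
  first : K * ∑ xs (g x) ≤ (∑[ _ ∈ xs ] 1) * N
  first = begin
    K * ∑ xs (g x)        ≡⟨ ∑-*ˡ xs K (g x) ⟨
    ∑[ y ∈ xs ] (K * g x y) ≤⟨ ∑-mono-avoiding _≟ᴬ_ x xs (head∉tail _≟ᴬ_ x xs rep) (bound x) ⟩
    ∑[ _ ∈ xs ] N         ≡⟨ ∑-cong xs (λ _ → sym (*-identityˡ N)) ⟩
    ∑[ _ ∈ xs ] (1 * N)   ≡⟨ ∑-*ʳ xs N (λ _ → 1) ⟩
    (∑[ _ ∈ xs ] 1) * N     ∎

module _ {E C : Set} (es : List E) (cs : List C) (p : E → C → Bool) where

  eventFree : ℕ
  eventFree = ∑[ c ∈ cs ] 𝟙 (every (λ e → not (p e c)) es)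

  incidences : ℕ
  incidences = ∑[ e ∈ es ] ∑[ c ∈ cs ] 𝟙 (p e c)

  eventFree+incidences : eventFree + incidences ≡
    ∑[ c ∈ cs ] (𝟙 (every (λ e → not (p e c)) es) + ∑[ e ∈ es ] 𝟙 (p e c))
  eventFree+incidences = trans (cong (eventFree +_) (∑-swap es cs (λ e c → 𝟙 (p e c)))) (sym (∑-+ cs _ _))

  bonferroni-∑ : eventFree + incidences ≤ length cs + ∑pairs es (λ e f → ∑[ c ∈ cs ] 𝟙 (p e c ∧ p f c))
  bonferroni-∑ = begin
    eventFree + incidences
      ≡⟨ eventFree+incidences ⟩
    ∑[ c ∈ cs ] (𝟙 (every (λ e → not (p e c)) es) + ∑[ e ∈ es ] 𝟙 (p e c))
      ≤⟨ ∑-mono cs (λ c → bonferroni (λ e → p e c) es) ⟩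
    ∑[ c ∈ cs ] (1 + ∑pairs es (λ e f → 𝟙 (p e c ∧ p f c)))
      ≡⟨ ∑-+ cs _ _ ⟩
    ∑[ _ ∈ cs ] 1 + ∑[ c ∈ cs ] ∑pairs es (λ e f → 𝟙 (p e c ∧ p f c))
      ≡⟨ cong₂ _+_ (∑-one cs) (∑pairs-∑ es cs (λ e f c → 𝟙 (p e c ∧ p f c))) ⟩
    length cs + ∑pairs es (λ e f → ∑[ c ∈ cs ] 𝟙 (p e c ∧ p f c)) ∎
    where open ≤-Reasoning

  union-bound-∑ : length cs ≤ eventFree + incidences
  union-bound-∑ = begin
    length cs     ≡⟨ ∑-one cs ⟨
    ∑[ _ ∈ cs ] 1 ≤⟨ ∑-mono cs (λ c → union-bound (λ e → p e c) es) ⟩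
    ∑[ c ∈ cs ] (𝟙 (every (λ e → not (p e c)) es) + ∑[ e ∈ es ] 𝟙 (p e c))
                  ≡⟨ eventFree+incidences ⟨
    eventFree + incidences ∎
    where open ≤-Reasoning

∑-overwrite : {A : Set} (xs : List A) (n : ℕ) (x : Fin n) (p : Vec A n → ℕ) →
  ∑[ c ∈ vecsOver xs n ] ∑[ a ∈ xs ] p (c [ x ]≔ a) ≡ length xs * ∑ (vecsOver xs n) p
∑-overwrite xs (suc n) zero p = begin
  ∑[ c ∈ vecsOver xs (suc n) ] ∑[ a ∈ xs ] p (c [ zero ]≔ a)
    ≡⟨ ∑-productWith _∷_ xs (vecsOver xs n) _ ⟩
  ∑[ b ∈ xs ] ∑[ c ∈ vecsOver xs n ] ∑[ a ∈ xs ] p (a ∷ c)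
    ≡⟨ ∑-const xs _ ⟩
  length xs * ∑[ c ∈ vecsOver xs n ] ∑[ a ∈ xs ] p (a ∷ c)
    ≡⟨ cong (length xs *_) (∑-swap xs (vecsOver xs n) (λ a c → p (a ∷ c))) ⟨
  length xs * ∑[ a ∈ xs ] ∑[ c ∈ vecsOver xs n ] p (a ∷ c)
    ≡⟨ cong (length xs *_) (∑-productWith _∷_ xs (vecsOver xs n) p) ⟨
  length xs * ∑ (vecsOver xs (suc n)) p ∎
  where open ≡-Reasoning
∑-overwrite xs (suc n) (suc x) p = begin
  ∑[ c ∈ vecsOver xs (suc n) ] ∑[ a ∈ xs ] p (c [ suc x ]≔ a)
    ≡⟨ ∑-productWith _∷_ xs (vecsOver xs n) _ ⟩
  ∑[ b ∈ xs ] ∑[ c ∈ vecsOver xs n ] ∑[ a ∈ xs ] p (b ∷ (c [ x ]≔ a))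
    ≡⟨ ∑-cong xs (λ b → ∑-overwrite xs n x (λ c → p (b ∷ c))) ⟩
  ∑[ b ∈ xs ] (length xs * ∑[ c ∈ vecsOver xs n ] p (b ∷ c))
    ≡⟨ ∑-*ˡ xs (length xs) _ ⟩
  length xs * ∑[ b ∈ xs ] ∑[ c ∈ vecsOver xs n ] p (b ∷ c)
    ≡⟨ cong (length xs *_) (∑-productWith _∷_ xs (vecsOver xs n) p) ⟨
  length xs * ∑ (vecsOver xs (suc n)) p ∎
  where open ≡-Reasoning

colourings : (m n : ℕ) → List (Vec (Fin m) n)
colourings m n = vecsOver (allFin m) n

length-colourings : (m n : ℕ) → length (colourings m n) ≡ m ^ n
length-colourings m n = trans (length-vecsOver (allFin m) n) (cong (_^ n) (length-allFin m))

module Colourings (m n : ℕ) where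

  Colouring : Set
  Colouring = Vec (Fin m) n

  agree : Fin n → Fin n → Colouring → Bool
  agree x y c = does (lookup c x Fin.≟ lookup c y)

  enumerates-colourings : Enumerates (Vec.≡-dec Fin._≟_) (colourings m n)
  enumerates-colourings = enumerates-vecsOver Fin._≟_ (enumerates-allFin m) n

  ∑-recolour : (x : Fin n) (p : Colouring → ℕ) →
    ∑[ c ∈ colourings m n ] ∑[ i ∈ allFin m ] p (c [ x ]≔ i) ≡ m * ∑ (colourings m n) p
  ∑-recolour x p = trans (∑-overwrite (allFin m) n x p) (cong (_* ∑ (colourings m n) p) (length-allFin m))

  pin : (x y : Fin n) → ¬ x ≡ y → (q : Colouring → ℕ) → (∀ c i → q (c [ x ]≔ i) ≡ q c) →
    m * ∑[ c ∈ colourings m n ] (𝟙 (agree x y c) * q c) ≡ ∑ (colourings m n) q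
  pin x y x≢y q q-ignores-x = begin
    m * ∑[ c ∈ colourings m n ] (𝟙 (agree x y c) * q c)
      ≡⟨ ∑-recolour x _ ⟨
    ∑[ c ∈ colourings m n ] ∑[ i ∈ allFin m ] (𝟙 (agree x y (c [ x ]≔ i)) * q (c [ x ]≔ i))
      ≡⟨ ∑-cong (colourings m n) (λ c → ∑-cong (allFin m) (λ i →
           cong₂ (λ a b → 𝟙 (does (a Fin.≟ b)) * q (c [ x ]≔ i))
                 (Vec.lookup∘update x c i) (Vec.lookup∘update′ (x≢y ∘ sym) c i))) ⟩
    ∑[ c ∈ colourings m n ] ∑[ i ∈ allFin m ] (𝟙 (does (i Fin.≟ lookup c y)) * q (c [ x ]≔ i))
      ≡⟨ ∑-cong (colourings m n) (λ c →
           trans (∑-cong (allFin m) (λ i → cong (𝟙 (does (i Fin.≟ lookup c y)) *_) (q-ignores-x c i)))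
                 (∑-indicator Fin._≟_ (allFin m) (enumerates-allFin m) (λ _ → q c) (lookup c y))) ⟩
    ∑ (colourings m n) q ∎
    where open ≡-Reasoning

  agreeing-count : (x y : Fin n) → ¬ x ≡ y →
    m * ∑[ c ∈ colourings m n ] 𝟙 (agree x y c) ≡ m ^ n
  agreeing-count x y x≢y = begin
    m * ∑[ c ∈ colourings m n ] 𝟙 (agree x y c)
      ≡⟨ cong (m *_) (∑-cong (colourings m n) (λ c → sym (*-identityʳ _))) ⟩
    m * ∑[ c ∈ colourings m n ] (𝟙 (agree x y c) * 1) ≡⟨ pin x y x≢y (λ _ → 1) (λ _ _ → refl) ⟩
    ∑[ _ ∈ colourings m n ] 1                         ≡⟨ ∑-one (colourings m n) ⟩
    length (colourings m n)                           ≡⟨ length-colourings m n ⟩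
    m ^ n                                             ∎
    where open ≡-Reasoning

  doubly-agreeing-count : (x x̄ y ȳ : Fin n) → ¬ x ≡ x̄ → ¬ x ≡ y → ¬ x ≡ ȳ → ¬ y ≡ ȳ →
    m * m * ∑[ c ∈ colourings m n ] 𝟙 (agree x x̄ c ∧ agree y ȳ c) ≡ m ^ n
  doubly-agreeing-count x x̄ y ȳ x≢x̄ x≢y x≢ȳ y≢ȳ = begin
    m * m * ∑[ c ∈ colourings m n ] 𝟙 (agree x x̄ c ∧ agree y ȳ c)
      ≡⟨ *-assoc m m _ ⟩
    m * (m * ∑[ c ∈ colourings m n ] 𝟙 (agree x x̄ c ∧ agree y ȳ c))
      ≡⟨ cong (λ z → m * (m * z)) (∑-cong (colourings m n) (λ c → 𝟙-∧ (agree x x̄ c) _)) ⟩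
    m * (m * ∑[ c ∈ colourings m n ] (𝟙 (agree x x̄ c) * 𝟙 (agree y ȳ c)))
      ≡⟨ cong (m *_) (pin x x̄ x≢x̄ (λ c → 𝟙 (agree y ȳ c)) y-ȳ-ignore-x) ⟩
    m * ∑[ c ∈ colourings m n ] 𝟙 (agree y ȳ c)
      ≡⟨ agreeing-count y ȳ y≢ȳ ⟩
    m ^ n ∎
    where
    open ≡-Reasoning
    y-ȳ-ignore-x : ∀ c i → 𝟙 (agree y ȳ (c [ x ]≔ i)) ≡ 𝟙 (agree y ȳ c)
    y-ȳ-ignore-x c i = cong₂ (λ a b → 𝟙 (does (a Fin.≟ b)))
      (Vec.lookup∘update′ (x≢y ∘ sym) c i) (Vec.lookup∘update′ (x≢ȳ ∘ sym) c i)

  matching-count : (x y : Fin n) → ¬ x ≡ y → (R : Fin m → Fin m → Bool) →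
    (∀ i i′ j → R i j ≡ true → R i′ j ≡ true → i ≡ i′) →
    m * ∑[ c ∈ colourings m n ] 𝟙 (R (lookup c x) (lookup c y)) ≤ m ^ n
  matching-count x y x≢y R matching = begin
    m * ∑[ c ∈ colourings m n ] 𝟙 (R (lookup c x) (lookup c y))
      ≡⟨ ∑-recolour x _ ⟨
    ∑[ c ∈ colourings m n ] ∑[ i ∈ allFin m ] 𝟙 (R (lookup (c [ x ]≔ i) x) (lookup (c [ x ]≔ i) y))
      ≡⟨ ∑-cong (colourings m n) (λ c → ∑-cong (allFin m) (λ i →
           cong₂ (λ a b → 𝟙 (R a b)) (Vec.lookup∘update x c i) (Vec.lookup∘update′ (x≢y ∘ sym) c i))) ⟩
    ∑[ c ∈ colourings m n ] ∑[ i ∈ allFin m ] 𝟙 (R i (lookup c y))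
      ≤⟨ ∑-mono (colourings m n) (λ c →
           count-at-most-once (λ i → R i (lookup c y)) (λ i i′ → matching i i′ (lookup c y))) ⟩
    ∑[ _ ∈ colourings m n ] 1
      ≡⟨ trans (∑-one (colourings m n)) (length-colourings m n) ⟩
    m ^ n ∎
    where open ≤-Reasoning

all-one : (k : ℕ) (f : Fin k → ℕ) → (∀ u → f u ≤ 1) → ∑ (allFin k) f ≡ k → ∀ u → f u ≡ 1
all-one (suc k) f f≤1 ∑f≡1+k u = at u
  where
  rest≤k : ∑[ i ∈ allFin k ] f (suc i) ≤ k
  rest≤k = ≤-trans (∑-mono (allFin k) (f≤1 ∘ suc))
                   (≤-reflexive (trans (∑-one (allFin k)) (length-allFin k)))
  split : ∀ a b → a ≤ 1 → b ≤ k → a + b ≡ suc k → a ≡ 1 × b ≡ k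
  split 0             b _         b≤k a+b≡1+k = ⊥-elim (1+n≰n (≤-trans (≤-reflexive (sym a+b≡1+k)) b≤k))
  split 1             b _         _   a+b≡1+k = refl , suc-injective a+b≡1+k
  split (suc (suc a)) b (s≤s ()) _   _
  head-and-rest : f zero ≡ 1 × ∑[ i ∈ allFin k ] f (suc i) ≡ k
  head-and-rest = split _ _ (f≤1 zero) rest≤k (trans (sym (∑-allFin-suc k f)) ∑f≡1+k)
  at : ∀ u → f u ≡ 1
  at zero    = proj₁ head-and-rest
  at (suc v) = all-one k (f ∘ suc) (f≤1 ∘ suc) (proj₂ head-and-rest) v

singleton : {m : ℕ} → Fin m → Vec Bool m
singleton a = tabulate (λ i → does (i Fin.≟ a))

no-member : {m : ℕ} (r : Vec Bool m) → ∑[ i ∈ allFin m ] 𝟙 (lookup r i) ≡ 0 →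
  r ≡ tabulate (λ _ → false)
no-member []          _     = refl
no-member {suc m} (b ∷ r) ∑≡0 with ∑′ ← trans (sym (∑-allFin-suc m (𝟙 ∘ lookup (b ∷ r)))) ∑≡0
  = cong₂ _∷_ (b≡false b (m+n≡0⇒m≡0 (𝟙 b) ∑′)) (no-member r (m+n≡0⇒n≡0 (𝟙 b) ∑′))
  where
  b≡false : ∀ b → 𝟙 b ≡ 0 → b ≡ false
  b≡false false _ = refl

one-member : {m : ℕ} (r : Vec Bool m) → ∑[ i ∈ allFin m ] 𝟙 (lookup r i) ≡ 1 →
  ∃[ a ] r ≡ singleton a
one-member {suc m} (b ∷ r) ∑≡1 with b | trans (sym (∑-allFin-suc m (𝟙 ∘ lookup (b ∷ r)))) ∑≡1
... | true  | 1+∑r≡1 = zero , cong (true ∷_) (no-member r (suc-injective 1+∑r≡1))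
... | false | ∑r≡1 with one-member r ∑r≡1
...   | a , r≡[a] = suc a , cong (false ∷_) r≡[a]

-- Colourings c : Fin n → Fin m correspond to the sets {(u , c u)} ⊆ V(H);
-- these are the subsets of V(H) of size n meeting every L(u) at most once.
module Encoding (m n : ℕ) where

  open Colourings m n using (Colouring)

  encode : Colouring → Subset n m
  encode = V.map singleton

  mem-encode : (c : Colouring) (u : Fin n) (i : Fin m) → mem (encode c) u i ≡ does (i Fin.≟ lookup c u)
  mem-encode c u i = trans (cong (λ r → lookup r i) (Vec.lookup-map u singleton c)) (Vec.lookup∘tabulate _ i)

  encode-injective : (c c′ : Colouring) → encode c ≡ encode c′ → c ≡ c′
  encode-injective c c′ same = begin
    c                    ≡⟨ Vec.tabulate∘lookup c ⟨
    tabulate (lookup c)  ≡⟨ Vec.tabulate-cong same-colour ⟩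
    tabulate (lookup c′) ≡⟨ Vec.tabulate∘lookup c′ ⟩
    c′                   ∎
    where
    open ≡-Reasoning
    same-colour : ∀ u → lookup c u ≡ lookup c′ u
    same-colour u = witness (lookup c u Fin.≟ lookup c′ u) (begin
      does (lookup c u Fin.≟ lookup c′ u) ≡⟨ mem-encode c′ u (lookup c u) ⟨
      mem (encode c′) u (lookup c u)      ≡⟨ cong (λ S → mem S u (lookup c u)) same ⟨
      mem (encode c) u (lookup c u)       ≡⟨ mem-encode c u (lookup c u) ⟩
      does (lookup c u Fin.≟ lookup c u)  ≡⟨ dec-true (lookup c u Fin.≟ lookup c u) refl ⟩
      true                                ∎)

  size≡∑ : (S : Subset n m) → size S ≡ ∑[ u ∈ allFin n ] ∑[ i ∈ allFin m ] 𝟙 (mem S u i)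
  size≡∑ S = trans (foldr-+-map (allFin n)) (∑-cong (allFin n) (λ u → count≡∑ (mem S u) (allFin m)))
    where
    foldr-+-map : (us : List (Fin n)) →
      foldr _+_ 0 (map (λ u → count (mem S u) (allFin m)) us) ≡ ∑[ u ∈ us ] count (mem S u) (allFin m)
    foldr-+-map []       = refl
    foldr-+-map (u ∷ us) = cong (_ +_) (foldr-+-map us)

  size-encode : (c : Colouring) → size (encode c) ≡ n
  size-encode c = begin
    size (encode c)                                               ≡⟨ size≡∑ (encode c) ⟩
    ∑[ u ∈ allFin n ] ∑[ i ∈ allFin m ] 𝟙 (mem (encode c) u i)     ≡⟨ ∑-cong (allFin n) one-each ⟩
    ∑[ u ∈ allFin n ] 1                                           ≡⟨ trans (∑-one (allFin n)) (length-allFin n) ⟩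
    n                                                             ∎
    where
    open ≡-Reasoning
    one-each : ∀ u → ∑[ i ∈ allFin m ] 𝟙 (mem (encode c) u i) ≡ 1
    one-each u = trans (∑-cong (allFin m) (λ i → cong 𝟙 (mem-encode c u i))) (enumerates-allFin m (lookup c u))

  decode : (S : Subset n m) → (∀ u i j → mem S u i ≡ true → mem S u j ≡ true → i ≡ j) →
    size S ≡ n → ∃[ c ] S ≡ encode c
  decode S fibre-once size≡n =
    rows S (all-one n _ (λ u → count-at-most-once (mem S u) (fibre-once u)) (trans (sym (size≡∑ S)) size≡n))
    where
    rows : ∀ {k} (R : Vec (Vec Bool m) k) → (∀ u → ∑[ i ∈ allFin m ] 𝟙 (lookup (lookup R u) i) ≡ 1) →
      ∃[ c ] R ≡ V.map singleton c
    rows []      _    = [] , refl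
    rows (r ∷ R) once with one-member r (once zero) | rows R (once ∘ suc)
    ... | a , r≡[a] | c , R≡c = a ∷ c , cong₂ _∷_ r≡[a] R≡c

  _≟ˢ_ : DecidableEquality (Subset n m)
  _≟ˢ_ = Vec.≡-dec (Vec.≡-dec Bool._≟_)

  subsets : List (Subset n m)
  subsets = vecsOver (vecsOver (true ∷ false ∷ []) m) n

  enumerates-subsets : Enumerates _≟ˢ_ subsets
  enumerates-subsets = enumerates-vecsOver _ (enumerates-vecsOver Bool._≟_ enumerates-bool m) n

-- Ordered pairs of vertices; an edge uv with u < v is recorded as (u , v).
pairs : (n : ℕ) → List (Fin n × Fin n)
pairs n = productWith _,_ (allFin n) (allFin n)

_≟ₚ_ : {n : ℕ} → DecidableEquality (Fin n × Fin n)
(u , v) ≟ₚ (a , b) = map′ (uncurry (cong₂ _,_)) (λ { refl → refl , refl }) (u Fin.≟ a ×-dec v Fin.≟ b)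

enumerates-pairs : (n : ℕ) → Enumerates _≟ₚ_ (pairs n)
enumerates-pairs n (a , b) =
  trans (occurrences-productWith Fin._≟_ Fin._≟_ _≟ₚ_ _,_ (λ _ _ _ _ → refl) (allFin n) (allFin n) a b)
        (cong₂ _*_ (enumerates-allFin n a) (enumerates-allFin n b))

-- Two distinct pairs a < b and a′ < b′ share at most one endpoint, so
-- one of a, b lies outside {a′, b′}.
endpoint-outside : {n : ℕ} (a b a′ b′ : Fin n) → a < b → a′ < b′ → ¬ (a′ , b′) ≡ (a , b) →
  (¬ a ≡ a′ × ¬ a ≡ b′) ⊎ (¬ b ≡ a′ × ¬ b ≡ b′)
endpoint-outside a b a′ b′ a<b a′<b′ distinct with a Fin.≟ a′ | a Fin.≟ b′ | b Fin.≟ a′ | b Fin.≟ b′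
... | no a≢a′  | no a≢b′  | _        | _        = inj₁ (a≢a′ , a≢b′)
... | _        | _        | no b≢a′  | no b≢b′  = inj₂ (b≢a′ , b≢b′)
... | yes a≡a′ | _        | yes b≡a′ | _        = ⊥-elim (Fin.<⇒≢ a<b (trans a≡a′ (sym b≡a′)))
... | yes a≡a′ | _        | no _     | yes b≡b′ = ⊥-elim (distinct (cong₂ _,_ (sym a≡a′) (sym b≡b′)))
... | no _     | yes a≡b′ | yes b≡a′ | _        =
  ⊥-elim (Fin.<-asym a<b (subst₂ _<_ (sym b≡a′) (sym a≡b′) a′<b′))
... | no _     | yes a≡b′ | no _     | yes b≡b′ = ⊥-elim (Fin.<⇒≢ a<b (trans a≡b′ (sym b≡b′)))

module HColourings {n : ℕ} (G : Graph n) (m : ℕ) where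

  open Colourings m n using (Colouring)
  open Encoding m n

  independent-elim : (H : Cover G m) (S : Subset n m) → isIndependent H S ≡ true →
    ∀ u i v j → not (mem S u i ∧ (mem S v j ∧ Hadj H u i v j)) ≡ true
  independent-elim H S indep u i v j =
    allF-elim _ (allF-elim _ (allF-elim _ (allF-elim _ indep u) i) v) j

  -- Since each fibre L(u) is a clique, an H-colouring meets it at most
  -- once, hence (having n elements) exactly once: it encodes a map.
  HColouring⇒encoding : (H : Cover G m) (S : Subset n m) → isHColoring H S ≡ true → ∃[ c ] S ≡ encode c
  HColouring⇒encoding H S hc = decode S fibre-once (witness (size S ℕ.≟ n) (trans (sym (isYes≗does _)) size≡n))
    where
    indep : isIndependent H S ≡ true
    indep = proj₁ (∧-true hc)
    size≡n : ⌊ size S ℕ.≟ n ⌋ ≡ true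
    size≡n = proj₂ (∧-true hc)
    fibre-once : ∀ u i j → mem S u i ≡ true → mem S u j ≡ true → i ≡ j
    fibre-once u i j i∈S j∈S with i Fin.≟ j
    ... | yes i≡j = i≡j
    ... | no  i≢j with independent-elim H S indep u i u j
    ...   | no-edge rewrite i∈S | j∈S | clique H u i j i≢j with () ← no-edge

  avoids⇒HColouring : (H : Cover G m) (c : Colouring) →
    (∀ u v → Hadj H u (lookup c u) v (lookup c v) ≡ false) → isHColoring H (encode c) ≡ true
  avoids⇒HColouring H c avoids = cong₂ _∧_ indep size≡n
    where
    no-edge : ∀ u i v j → not (mem (encode c) u i ∧ (mem (encode c) v j ∧ Hadj H u i v j)) ≡ true
    no-edge u i v j rewrite mem-encode c u i | mem-encode c v j with i Fin.≟ lookup c u | j Fin.≟ lookup c v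
    ... | yes refl | yes refl rewrite avoids u v = refl
    ... | yes _    | no  _    = refl
    ... | no  _    | _        = refl
    indep : isIndependent H (encode c) ≡ true
    indep = allF-intro _ λ u → allF-intro _ λ i → allF-intro _ λ v → allF-intro _ λ j → no-edge u i v j
    size≡n : ⌊ size (encode c) ℕ.≟ n ⌋ ≡ true
    size≡n = trans (isYes≗does (size (encode c) ℕ.≟ n)) (dec-true (size (encode c) ℕ.≟ n) (size-encode c))

  -- The trivial cover: L(u) = {u} × Fin m is a clique and (u , i) ~ (v , i)
  -- along every edge uv.  Its H-colourings are the proper colourings.
  trivialAdj : Fin n → Fin m → Fin n → Fin m → Bool
  trivialAdj u i v j = if does (u Fin.≟ v) then not (does (i Fin.≟ j)) else (adj G u v ∧ does (i Fin.≟ j))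

  trivialCover : Cover G m
  trivialCover = record
    { Hadj     = trivialAdj
    ; Hsym     = λ u i v j → trans
        (cong₂ (λ a b → if a then not b else (adj G u v ∧ b)) (does-sym Fin._≟_ u v) (does-sym Fin._≟_ i j))
        (cong (λ a → if does (v Fin.≟ u) then _ else (a ∧ _)) (Graph.sym G u v))
    ; Hirrefl  = λ u i → cong₂ (λ a b → if a then not b else (adj G u u ∧ b))
                               (dec-true (u Fin.≟ u) refl) (dec-true (i Fin.≟ i) refl)
    ; clique   = λ u i j i≢j → cong₂ (λ a b → if a then not b else (adj G u u ∧ b))
                                     (dec-true (u Fin.≟ u) refl) (dec-false (i Fin.≟ j) i≢j)
    ; onlyEdge = λ u v i j u≢v → proj₁ ∘ ∧-true ∘ across u v i j u≢v
    ; matching = λ u v i j j′ u≢v e e′ →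
        trans (sym (witness (i Fin.≟ j) (proj₂ (∧-true (across u v i j u≢v e)))))
              (witness (i Fin.≟ j′) (proj₂ (∧-true (across u v i j′ u≢v e′))))
    }
    where
    across : ∀ u v i j → ¬ u ≡ v → trivialAdj u i v j ≡ true → adj G u v ∧ does (i Fin.≟ j) ≡ true
    across u v i j u≢v = subst (λ a → (if a then _ else _) ≡ true) (dec-false (u Fin.≟ v) u≢v)

  trivialCover-proper : (c : Colouring) → isHColoring trivialCover (encode c) ≡ true → isProper G c ≡ true
  trivialCover-proper c hc = allF-intro _ λ u → allF-intro _ λ v → proper-at u v
    where
    avoids : ∀ u v → trivialAdj u (lookup c u) v (lookup c v) ≡ false
    avoids u v with independent-elim trivialCover (encode c) (proj₁ (∧-true hc)) u (lookup c u) v (lookup c v)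
    ... | no-edge rewrite mem-encode c u (lookup c u) | mem-encode c v (lookup c v)
                        | dec-true (lookup c u Fin.≟ lookup c u) refl | dec-true (lookup c v Fin.≟ lookup c v) refl
                        with trivialAdj u (lookup c u) v (lookup c v)
    ...   | false = refl
    proper-at : ∀ u v → not (adj G u v ∧ eqF (lookup c u) (lookup c v)) ≡ true
    proper-at u v with u Fin.≟ v | avoids u v
    ... | yes refl | _ rewrite irrefl G u = refl
    ... | no  _    | adj∧same≡false rewrite isYes≗does (lookup c u Fin.≟ lookup c v) | adj∧same≡false = refl


  DP≤chromatic : PDPcover trivialCover ≤ P G m
  DP≤chromatic = begin
    PDPcover trivialCover
      ≡⟨ count≡∑ (isHColoring trivialCover) subsets ⟩
    ∑[ S ∈ subsets ] 𝟙 (isHColoring trivialCover S)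
      ≤⟨ count-surjection (Vec.≡-dec Fin._≟_) _≟ˢ_ (colourings m n) subsets
           (Colourings.enumerates-colourings m n) enumerates-subsets encode
           (isHColoring trivialCover) (isProper G) decoded ⟩
    ∑[ c ∈ colourings m n ] 𝟙 (isProper G c)
      ≡⟨ count≡∑ (isProper G) (colourings m n) ⟨
    P G m ∎
    where
    open ≤-Reasoning
    decoded : ∀ S → isHColoring trivialCover S ≡ true → ∃[ c ] S ≡ encode c × isProper G c ≡ true
    decoded S hc with HColouring⇒encoding trivialCover S hc
    ... | c , refl = c , refl , trivialCover-proper c hc

module Conflicts {n : ℕ} (G : Graph n) (m : ℕ) where

  open Colourings m n
  open Encoding m n
  open HColourings G m

  isEdge : Fin n × Fin n → Bool
  isEdge (u , v) = does (u Fin.<? v) ∧ adj G u v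

  isEdge⇒< : ∀ u v → isEdge (u , v) ≡ true → u < v
  isEdge⇒< u v edge = witness (u Fin.<? v) (proj₁ (∧-true edge))

  -- A relation between coloured vertices (u , i) and (v , j): the edge
  -- relation of a cover, or "same colour" for ordinary colourings.
  Relation : Set
  Relation = Fin n → Fin m → Fin n → Fin m → Bool

  sameColour : Relation
  sameColour _ i _ j = does (i Fin.≟ j)

  conflict : Relation → Fin n × Fin n → Colouring → Bool
  conflict R (u , v) c = isEdge (u , v) ∧ R u (lookup c u) v (lookup c v)

  conflictFree : Relation → Colouring → Bool
  conflictFree R c = every (λ e → not (conflict R e c)) (pairs n)

  proper⇒conflictFree : (c : Colouring) → isProper G c ≡ true → conflictFree sameColour c ≡ true
  proper⇒conflictFree c proper = every-intro _ (pairs n) no-conflict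
    where
    strengthen : ∀ l {a b} → not (a ∧ b) ≡ true → not ((l ∧ a) ∧ b) ≡ true
    strengthen true  ok = ok
    strengthen false _  = refl
    no-conflict : ∀ e → not (conflict sameColour e c) ≡ true
    no-conflict (u , v) = strengthen (does (u Fin.<? v))
      (trans (cong (λ b → not (adj G u v ∧ b)) (sym (isYes≗does (lookup c u Fin.≟ lookup c v))))
             (allF-elim _ (allF-elim _ proper u) v))

  -- A colouring free of H-conflicts avoids every edge of H: edges
  -- between distinct fibres lie over edges of G, H is symmetric and has
  -- no loops.
  conflictFree⇒avoids< : (H : Cover G m) (c : Colouring) → conflictFree (Hadj H) c ≡ true →
    ∀ u v → u < v → Hadj H u (lookup c u) v (lookup c v) ≡ false
  conflictFree⇒avoids< H c free u v u<v with adj G u v in uv | Hadj H u (lookup c u) v (lookup c v) in edge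
  ... | _     | false = refl
  ... | false | true  with () ← trans (sym uv) (onlyEdge H u v _ _ (Fin.<⇒≢ u<v) edge)
  ... | true  | true  with every-elim _ (pairs n) free (∈-productWith _,_ (∈-allFin u) (∈-allFin v))
  ...   | no-conflict rewrite dec-true (u Fin.<? v) u<v | uv | edge with () ← no-conflict

  conflictFree⇒avoids : (H : Cover G m) (c : Colouring) → conflictFree (Hadj H) c ≡ true →
    ∀ u v → Hadj H u (lookup c u) v (lookup c v) ≡ false
  conflictFree⇒avoids H c free u v with Fin.<-cmp u v
  ... | tri< u<v _ _  = conflictFree⇒avoids< H c free u v u<v
  ... | tri≈ _ refl _ = Hirrefl H u (lookup c u)
  ... | tri> _ _ v<u  = trans (Hsym H u _ v _) (conflictFree⇒avoids< H c free v u v<u)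

  -- Along an edge, a cover produces at most as many conflicting
  -- colourings (≤ m^(n-1), by the matching condition) as equality of
  -- colours does (exactly m^(n-1)).
  cover-conflicts≤ : 1 ≤ m → (H : Cover G m) (u v : Fin n) →
    ∑[ c ∈ colourings m n ] 𝟙 (isEdge (u , v) ∧ Hadj H u (lookup c u) v (lookup c v))
      ≤ ∑[ c ∈ colourings m n ] 𝟙 (isEdge (u , v) ∧ agree u v c)
  cover-conflicts≤ m≥1 H u v with isEdge (u , v) in edge
  ... | false = ≤-trans (≤-reflexive (∑-zero (colourings m n))) z≤n
  ... | true  = *-cancelˡ-≤ m {{>-nonZero m≥1}} (begin
    m * ∑[ c ∈ colourings m n ] 𝟙 (Hadj H u (lookup c u) v (lookup c v))
      ≤⟨ matching-count u v u≢v _ fibres-matched ⟩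
    m ^ n
      ≡⟨ agreeing-count u v u≢v ⟨
    m * ∑[ c ∈ colourings m n ] 𝟙 (agree u v c) ∎)
    where
    open ≤-Reasoning
    u≢v : ¬ u ≡ v
    u≢v = Fin.<⇒≢ (isEdge⇒< u v edge)
    fibres-matched : ∀ i i′ j → Hadj H u i v j ≡ true → Hadj H u i′ v j ≡ true → i ≡ i′
    fibres-matched i i′ j ij i′j =
      matching H v u j i i′ (u≢v ∘ sym) (trans (Hsym H v j u i) ij) (trans (Hsym H v j u i′) i′j)

  vanishing : {f : Colouring → ℕ} → (∀ c → f c ≡ 0) → m * m * ∑ (colourings m n) f ≤ m ^ n
  vanishing {f} f≡0 = begin
    m * m * ∑ (colourings m n) f       ≡⟨ cong (m * m *_) (∑-cong (colourings m n) f≡0) ⟩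
    m * m * ∑[ _ ∈ colourings m n ] 0 ≡⟨ cong (m * m *_) (∑-zero (colourings m n)) ⟩
    m * m * 0                         ≡⟨ *-zeroʳ (m * m) ⟩
    0                                 ≤⟨ z≤n ⟩
    m ^ n                             ∎
    where open ≤-Reasoning

  double-conflicts : (a b a′ b′ : Fin n) → ¬ (a′ , b′) ≡ (a , b) →
    m * m * ∑[ c ∈ colourings m n ]
              𝟙 ((isEdge (a , b) ∧ agree a b c) ∧ (isEdge (a′ , b′) ∧ agree a′ b′ c)) ≤ m ^ n
  double-conflicts a b a′ b′ distinct with isEdge (a , b) in ab | isEdge (a′ , b′) in a′b′
  ... | false | _     = vanishing (λ c → refl)
  ... | true  | false = vanishing (λ c → cong 𝟙 (Bool.∧-zeroʳ (agree a b c)))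
  ... | true  | true  = ≤-reflexive (split (endpoint-outside a b a′ b′ a<b a′<b′ distinct))
    where
    a<b : a < b
    a<b = isEdge⇒< a b ab
    a′<b′ : a′ < b′
    a′<b′ = isEdge⇒< a′ b′ a′b′
    split : (¬ a ≡ a′ × ¬ a ≡ b′) ⊎ (¬ b ≡ a′ × ¬ b ≡ b′) →
      m * m * ∑[ c ∈ colourings m n ] 𝟙 (agree a b c ∧ agree a′ b′ c) ≡ m ^ n
    split (inj₁ (a≢a′ , a≢b′)) = doubly-agreeing-count a b a′ b′ (Fin.<⇒≢ a<b) a≢a′ a≢b′ (Fin.<⇒≢ a′<b′)
    split (inj₂ (b≢a′ , b≢b′)) = trans
      (cong (m * m *_) (∑-cong (colourings m n) (λ c →
         cong (λ s → 𝟙 (s ∧ agree a′ b′ c)) (does-sym Fin._≟_ (lookup c a) (lookup c b)))))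
      (doubly-agreeing-count b a a′ b′ (Fin.<⇒≢ a<b ∘ sym) b≢a′ b≢b′ (Fin.<⇒≢ a′<b′))

  chromatic≤conflictFree : P G m ≤ ∑[ c ∈ colourings m n ] 𝟙 (conflictFree sameColour c)
  chromatic≤conflictFree = ≤-trans (≤-reflexive (count≡∑ (isProper G) (colourings m n)))
    (∑-mono (colourings m n) (λ c → 𝟙-mono (proper⇒conflictFree c)))

  conflictFree≤DP : (H : Cover G m) → ∑[ c ∈ colourings m n ] 𝟙 (conflictFree (Hadj H) c) ≤ PDPcover H
  conflictFree≤DP H = begin
    ∑[ c ∈ colourings m n ] 𝟙 (conflictFree (Hadj H) c)
      ≤⟨ ∑-mono (colourings m n) (λ c → 𝟙-mono (avoids⇒HColouring H c ∘ conflictFree⇒avoids H c)) ⟩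
    ∑[ c ∈ colourings m n ] 𝟙 (isHColoring H (encode c))
      ≤⟨ count-injection (Vec.≡-dec Fin._≟_) _≟ˢ_ (colourings m n) subsets
           enumerates-colourings enumerates-subsets encode encode-injective (isHColoring H) ⟩
    ∑[ S ∈ subsets ] 𝟙 (isHColoring H S)
      ≡⟨ count≡∑ (isHColoring H) subsets ⟨
    PDPcover H ∎
    where open ≤-Reasoning

  doubleConflicts : ℕ
  doubleConflicts = ∑pairs (pairs n) (λ e f →
    ∑[ c ∈ colourings m n ] 𝟙 (conflict sameColour e c ∧ conflict sameColour f c))

  conflicts : Relation → ℕ
  conflicts R = ∑[ e ∈ pairs n ] ∑[ c ∈ colourings m n ] 𝟙 (conflict R e c)

  -- Bonferroni for proper colourings, the union bound for H-colourings, and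
  -- the comparison of conflict counts give P(G,m) ≤ P_DP(G,H) + doubleConflicts.
  chromatic≤DP+doubleConflicts : 1 ≤ m → (H : Cover G m) → P G m ≤ PDPcover H + doubleConflicts
  chromatic≤DP+doubleConflicts m≥1 H = +-cancelʳ-≤ S₁ _ _ (begin
    P G m + S₁
      ≤⟨ +-monoˡ-≤ S₁ chromatic≤conflictFree ⟩
    ∑[ c ∈ colourings m n ] 𝟙 (conflictFree sameColour c) + S₁
      ≤⟨ bonferroni-∑ (pairs n) (colourings m n) (conflict sameColour) ⟩
    length (colourings m n) + X
      ≤⟨ +-monoˡ-≤ X (union-bound-∑ (pairs n) (colourings m n) (conflict (Hadj H))) ⟩
    ∑[ c ∈ colourings m n ] 𝟙 (conflictFree (Hadj H) c) + conflicts (Hadj H) + X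
      ≤⟨ +-monoˡ-≤ X (+-mono-≤ (conflictFree≤DP H)
                                (∑-mono (pairs n) (λ (u , v) → cover-conflicts≤ m≥1 H u v))) ⟩
    PDPcover H + S₁ + X
      ≡⟨ xy∙z≈xz∙y (PDPcover H) S₁ X ⟩
    PDPcover H + X + S₁ ∎)
    where
    open ≤-Reasoning
    S₁ X : ℕ
    S₁ = conflicts sameColour
    X  = doubleConflicts

  doubleConflicts-bound : m * m * doubleConflicts ≤ ∑pairs (pairs n) (λ _ _ → 1) * m ^ n
  doubleConflicts-bound =
    ∑pairs-bound _≟ₚ_ (pairs n) (enumerates⇒repetitionFree _≟ₚ_ (pairs n) (enumerates-pairs n))
      _ (m * m) (m ^ n) (λ (a , b) (a′ , b′) distinct → double-conflicts a b a′ b′ distinct)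

theorem1p7 : (n : ℕ) (G : Graph n) →
    ∃[ C ] ∃[ M ] ∀ (m : ℕ) → M ≤ m → ∀ (k : ℕ) → IsPDP G m k →
      ∣ P G m - k ∣ * m ^ 2 ≤ C * m ^ n
theorem1p7 n G = C , 1 , bound
  where
  C : ℕ
  C = ∑pairs (pairs n) (λ _ _ → 1)
  bound : ∀ m → 1 ≤ m → ∀ k → IsPDP G m k → ∣ P G m - k ∣ * m ^ 2 ≤ C * m ^ n
  bound m m≥1 k ((H , DP[H]≡k) , minimal) = begin
    ∣ P G m - k ∣ * m ^ 2                ≡⟨ cong (_* m ^ 2) (m≤n⇒∣n-m∣≡n∸m k≤P) ⟩
    (P G m ∸ k) * m ^ 2                 ≤⟨ *-monoˡ-≤ (m ^ 2) (m≤n+o⇒m∸n≤o (P G m) k P≤k+X) ⟩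
    doubleConflicts * m ^ 2             ≡⟨ cong (λ z → doubleConflicts * (m * z)) (*-identityʳ m) ⟩
    doubleConflicts * (m * m)           ≡⟨ *-comm doubleConflicts (m * m) ⟩
    m * m * doubleConflicts             ≤⟨ doubleConflicts-bound ⟩
    C * m ^ n                           ∎
    where
    open HColourings G m using (trivialCover; DP≤chromatic)
    open Conflicts G m using (doubleConflicts; chromatic≤DP+doubleConflicts; doubleConflicts-bound)
    open ≤-Reasoning
    k≤P : k ≤ P G m
    k≤P = ≤-trans (minimal trivialCover) DP≤chromatic
    P≤k+X : P G m ≤ k + doubleConflicts
    P≤k+X = subst (λ d → P G m ≤ d + doubleConflicts) DP[H]≡k (chromatic≤DP+doubleConflicts m≥1 H)
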